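{- Let $T$ be a tree of order at least four with no vertex of degree two, and let $G$ be its Halin graph. Then $D(G)\leq 4$. Moreover, equality holds when $T=K_{1,3}$.
   Context: Given a tree $T$ with at least four vertices and no vertex of degree two, embedded in the plane without edge crossings, the Halin graph of $T$ is obtained from $T$ by adding a cycle through all leaves of $T$, connecting them in their clockwise order in the embedding. A vertex labeling $\phi:V(G)\to\{1,\dots,r\}$ is $r$-distinguishing if the only automorphism of $G$ preserving all vertex labels is the identity. The distinguishing number $D(G)$ is the least $r$ such that $G$ has an $r$-distinguishing vertex labeling. -}

module Defs where

open import Data.Nat using (ℕ; zero; suc; _≤_; _<_; _≟_)
open import Data.Fin using (Fin)
import Data.Fin as F
open import Data.List using (List; []; _∷_; _++_; map; filter; length; [_])
open import Data.List.Membership.Propositional using (_∈_)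
open import Data.Product using (Σ; ∃; _×_; _,_; proj₁)
open import Data.Sum using (_⊎_; inj₁; inj₂)
open import Data.Empty using (⊥)
open import Relation.Nullary using (¬_; Dec; yes; no)
open import Relation.Nullary.Decidable using (map′; _⊎-dec_)
open import Relation.Binary.PropositionalEquality using (_≡_)
open import Function.Bundles using (_↔_; Inverse)

record Graph : Set₁ where
  field
    V   : Set
    Adj : V → V → Set
open Graph public

record Iso (G H : Graph) : Set where
  field
    bij      : V G ↔ V H
    preserve : ∀ u v → Adj G u v → Adj H (Inverse.to bij u) (Inverse.to bij v)
    reflect  : ∀ u v → Adj H (Inverse.to bij u) (Inverse.to bij v) → Adj G u v

Aut : Graph → Set
Aut G = Iso G G

-- A labeling with labels {1,…,r}, represented as Fin r, is r-distinguishing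
-- if the only label-preserving automorphism is the identity.
Distinguishing : (G : Graph) (r : ℕ) → (V G → Fin r) → Set
Distinguishing G r φ =
  (σ : Aut G) → (∀ v → φ (Inverse.to (Iso.bij σ) v) ≡ φ v) →
  ∀ v → Inverse.to (Iso.bij σ) v ≡ v

HasDist : Graph → ℕ → Set
HasDist G r = Σ (V G → Fin r) (Distinguishing G r)

-- D(G) ≤ d   (D(G) is the least r with an r-distinguishing labeling).
DLe : Graph → ℕ → Set
DLe G d = Σ ℕ λ r → r ≤ d × HasDist G r

DEq : Graph → ℕ → Set
DEq G d = HasDist G d × (∀ r → r < d → ¬ HasDist G r)

-- Plane trees.  A tree embedded in the plane is encoded (as usual) by a
-- rooted ordered tree: every vertex lists its children in clockwise order.

data PTree : Set where
  node : List PTree → PTree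

-- Vertices (positions) of a plane tree.
data Pos : PTree → Set
data PosL : List PTree → Set

data Pos where
  root : ∀ {ts} → Pos (node ts)
  sub  : ∀ {ts} → PosL ts → Pos (node ts)

data PosL where
  here  : ∀ {t ts} → Pos t → PosL (t ∷ ts)
  there : ∀ {t ts} → PosL ts → PosL (t ∷ ts)

-- TopL l : l points to the root of one of the children.
data TopL : ∀ {ts} → PosL ts → Set where
  here  : ∀ {us ts} → TopL {node us ∷ ts} (here root)
  there : ∀ {t ts} {l : PosL ts} → TopL l → TopL {t ∷ ts} (there l)

-- Par p c : p is the parent of c.
data Par : ∀ {t} → Pos t → Pos t → Set
data ParL : ∀ {ts} → PosL ts → PosL ts → Set

data Par where
  top  : ∀ {ts} {l : PosL ts} → TopL l → Par {node ts} root (sub l)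
  down : ∀ {ts} {l l' : PosL ts} → ParL l l' → Par {node ts} (sub l) (sub l')

data ParL where
  here  : ∀ {t ts} {p q : Pos t} → Par p q → ParL {t ∷ ts} (here p) (here q)
  there : ∀ {t ts} {l l' : PosL ts} → ParL l l' → ParL {t ∷ ts} (there l) (there l')

topL? : ∀ {ts} (l : PosL ts) → Dec (TopL l)
topL? (here root)    = yes here
topL? (here (sub _)) = no λ ()
topL? (there l)      = map′ there (λ { (there x) → x }) (topL? l)

par? : ∀ {t} (p q : Pos t) → Dec (Par p q)
parL? : ∀ {ts} (l l' : PosL ts) → Dec (ParL l l')
par? root root       = no λ ()
par? root (sub l)    = map′ top (λ { (top x) → x }) (topL? l)
par? (sub l) root    = no λ ()
par? (sub l) (sub m) = map′ down (λ { (down x) → x }) (parL? l m)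
parL? (here p) (here q)   = map′ here (λ { (here x) → x }) (par? p q)
parL? (here p) (there m)  = no λ ()
parL? (there l) (here q)  = no λ ()
parL? (there l) (there m) = map′ there (λ { (there x) → x }) (parL? l m)

AdjT : ∀ {t} → Pos t → Pos t → Set
AdjT u v = Par u v ⊎ Par v u

adjT? : ∀ {t} (u v : Pos t) → Dec (AdjT u v)
adjT? u v = par? u v ⊎-dec par? v u

allPos  : (t : PTree) → List (Pos t)
allPosL : (ts : List PTree) → List (PosL ts)
allPos (node ts) = root ∷ map sub (allPosL ts)
allPosL []       = []
allPosL (t ∷ ts) = map here (allPos t) ++ map there (allPosL ts)

TreeGraph : PTree → Graph
TreeGraph t = record { V = Pos t ; Adj = AdjT }

order : PTree → ℕ
order t = length (allPos t)

deg : (t : PTree) → Pos t → ℕ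
deg t v = length (filter (λ u → adjT? v u) (allPos t))

-- Leaves of T (degree-one vertices) in the cyclic (clockwise) order of
-- the embedding: the preorder traversal meets them in that order.
leaves : (t : PTree) → List (Pos t)
leaves t = filter (λ v → deg t v ≟ 1) (allPos t)

consec : {A : Set} → List A → List (A × A)
consec []           = []
consec (x ∷ [])     = []
consec (x ∷ y ∷ xs) = (x , y) ∷ consec (y ∷ xs)

cyclePairs : {A : Set} → List A → List (A × A)
cyclePairs []       = []
cyclePairs (x ∷ xs) = consec ((x ∷ xs) ++ [ x ])

AdjC : ∀ {t} → Pos t → Pos t → Set
AdjC {t} u v = ((u , v) ∈ cyclePairs (leaves t)) ⊎ ((v , u) ∈ cyclePairs (leaves t))

Halin : PTree → Graph
Halin t = record { V = Pos t ; Adj = λ u v → AdjT u v ⊎ AdjC u v }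

data AdjK13 : Fin 4 → Fin 4 → Set where
  out : ∀ {i : Fin 4} → ¬ i ≡ F.zero → AdjK13 F.zero i
  inn : ∀ {i : Fin 4} → ¬ i ≡ F.zero → AdjK13 i F.zero

K13 : Graph
K13 = record { V = Fin 4 ; Adj = AdjK13 }

module Submission where

-- Label every non-leaf of T by 3, the first two leaves of the
-- leaf cycle by 1 and 2, and all other leaves by 0.  A label-preserving
-- automorphism σ of G maps leaves to leaves.  Since no two leaves of a tree
-- with at least four vertices are adjacent in T, σ maps the leaf cycle onto
-- itself; fixing two consecutive cycle vertices, it fixes the whole cycle
-- (cycle rigidity).  Then σ fixes every vertex by induction on height: a
-- non-leaf has a child, already fixed, and σ must send it to that child's parent.
--
-- A tree isomorphic to K_{1,3} has four vertices; the trees with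
-- four vertices and no vertex of degree two are the two rootings of the star,
-- whose Halin graph is K₄ (checked by evaluation).  In a complete graph on n
-- vertices, fewer than n labels repeat a label, and swapping two equally
-- labelled vertices is a nontrivial label-preserving automorphism.

open import Defs
open import Data.Nat using (ℕ; suc; _≤_; _<_; z≤n; s≤s; _⊔_) renaming (_≟_ to _≟ℕ_)
open import Data.Nat.Properties
  using (m≤n⇒m≤1+n; ≤-refl; ≤-trans; ≤-antisym; <-trans; <-irrefl; m≤m⊔n; m≤n⊔m)
open import Data.Nat.Induction using (<-wellFounded)
open import Data.Fin using (Fin; zero; suc; #_; _≟_)
open import Data.Fin.Properties using (injective⇒≤; pigeonhole) renaming (<-irrefl to <ᶠ-irrefl)
open import Data.Fin.Permutation using (transpose)
import Data.Fin.Permutation.Components as PC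
open import Data.List using (List; []; _∷_; _++_; map; filter; length; lookup; take; [_])
open import Data.List.Properties using (++-assoc)
open import Data.List.Relation.Unary.Any using (here; there)
open import Data.List.Relation.Unary.All as All using (all?)
open import Data.List.Relation.Unary.AllPairs using ([]; _∷_; tail)
open import Data.List.Relation.Unary.Unique.Propositional using (Unique)
import Data.List.Relation.Unary.Unique.Propositional.Properties as Unique
open import Data.List.Membership.Propositional using (_∈_; _∉_)
open import Data.List.Membership.Propositional.Properties
  using (∈-lookup; ∈-map⁺; ∈-map⁻; ∈-++⁻; ∈-++⁺ˡ; ∈-++⁺ʳ; ∈-filter⁺; ∈-filter⁻)
import Data.List.Membership.DecPropositional as DecMembership
open import Data.Product using (∃; _×_; _,_; proj₁; proj₂)
open import Data.Product.Properties using (≡-dec)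
open import Data.Sum using (_⊎_; inj₁; inj₂)
open import Data.Empty using (⊥; ⊥-elim)
open import Function using (_∘_)
open import Function.Bundles using (_↔_; Inverse; Injection)
open import Function.Definitions using (Injective)
open import Function.Properties.Inverse using (Inverse⇒Injection; ↔-sym; ↔-trans)
import Induction.WellFounded as WF
import Level
import Relation.Binary.Construct.On as On
open import Relation.Binary.Definitions using (DecidableEquality)
open import Relation.Binary.PropositionalEquality using (_≡_; _≢_; refl; sym; trans; cong; subst)
open import Relation.Nullary using (¬_; Dec; yes; no)
open import Relation.Nullary.Decidable using (True; toWitness; _×-dec_; _→-dec_; _⊎-dec_; ¬?)

module _ {A : Set} where

  lookup-injective : ∀ {xs : List A} → Unique xs → ∀ i j → lookup xs i ≡ lookup xs j → i ≡ j
  lookup-injective (_ ∷ _) zero zero _ = refl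
  lookup-injective (x∉ ∷ _) zero (suc j) e = ⊥-elim (All.lookup x∉ (∈-lookup j) e)
  lookup-injective (x∉ ∷ _) (suc i) zero e = ⊥-elim (All.lookup x∉ (∈-lookup i) (sym e))
  lookup-injective (_ ∷ u) (suc i) (suc j) e = cong suc (lookup-injective u i j e)

  unique-length-≤ : ∀ {n} {xs : List A} → Unique xs → (f : A → Fin n) →
                    Injective _≡_ _≡_ f → length xs ≤ n
  unique-length-≤ u f f-inj = injective⇒≤ (λ e → lookup-injective u _ _ (f-inj e))

  two-members-length : ∀ {ys : List A} {a b} → a ∈ ys → b ∈ ys → a ≢ b → 2 ≤ length ys
  two-members-length (here refl) (here refl) a≢b = ⊥-elim (a≢b refl)
  two-members-length (here _) (there (here _)) _ = s≤s (s≤s z≤n)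
  two-members-length (here _) (there (there _)) _ = s≤s (s≤s z≤n)
  two-members-length (there (here _)) (here _) _ = s≤s (s≤s z≤n)
  two-members-length (there (there _)) (here _) _ = s≤s (s≤s z≤n)
  two-members-length (there a∈) (there b∈) a≢b = m≤n⇒m≤1+n (two-members-length a∈ b∈ a≢b)

  constant-unique-length : ∀ {ys : List A} {a} → Unique ys → a ∈ ys →
                           (∀ {y} → y ∈ ys → y ≡ a) → length ys ≡ 1
  constant-unique-length (_ ∷ []) _ _ = refl
  constant-unique-length (y∉ ∷ _ ∷ _) _ all-a =
    ⊥-elim (All.lookup y∉ (here refl) (trans (all-a (here refl)) (sym (all-a (there (here refl))))))

  unique-++-disjoint : ∀ (P : List A) {Q} {x : A} → Unique (P ++ Q) → x ∈ Q → x ∉ P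
  unique-++-disjoint (p ∷ P) (p∉ ∷ _) x∈Q (here refl) = All.lookup p∉ (∈-++⁺ʳ P x∈Q) refl
  unique-++-disjoint (p ∷ P) (_ ∷ u) x∈Q (there x∈P) = unique-++-disjoint P u x∈Q x∈P

  unique-++ʳ : ∀ P {Q : List A} → Unique (P ++ Q) → Unique Q
  unique-++ʳ [] u = u
  unique-++ʳ (_ ∷ P) (_ ∷ u) = unique-++ʳ P u

  take-⊆ : ∀ n {L : List A} {x} → x ∈ take n L → x ∈ L
  take-⊆ (suc n) {_ ∷ _} (here x≡y) = here x≡y
  take-⊆ (suc n) {_ ∷ _} (there x∈) = there (take-⊆ n x∈)

  head-++ : ∀ (P : List A) {a y : A} {R ys} → P ++ a ∷ R ≡ y ∷ ys → y ≡ a ⊎ y ∈ P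
  head-++ [] refl = inj₁ refl
  head-++ (p ∷ P) refl = inj₂ (here refl)

  consec-mem : ∀ {xs : List A} {u v} → (u , v) ∈ consec xs → u ∈ xs × v ∈ xs
  consec-mem {x ∷ y ∷ _} (here refl) = here refl , there (here refl)
  consec-mem {x ∷ y ∷ _} (there m) = let (u∈ , v∈) = consec-mem m in there u∈ , there v∈

  cyclePairs-mem : ∀ {xs : List A} {u v} → (u , v) ∈ cyclePairs xs → u ∈ xs × v ∈ xs
  cyclePairs-mem {x ∷ xs} m = let (u∈ , v∈) = consec-mem m in close u∈ , close v∈
    where
    close : ∀ {y} → y ∈ (x ∷ xs) ++ [ x ] → y ∈ x ∷ xs
    close y∈ with ∈-++⁻ (x ∷ xs) y∈
    ... | inj₁ y∈xs = y∈xs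
    ... | inj₂ (here refl) = here refl

  consec-∷⁻ : ∀ {p : A} {xs u v} → (u , v) ∈ consec (p ∷ xs) →
              (u ≡ p × ∃ λ ys → xs ≡ v ∷ ys) ⊎ (u , v) ∈ consec xs
  consec-∷⁻ {xs = y ∷ ys} (here refl) = inj₁ (refl , ys , refl)
  consec-∷⁻ {xs = y ∷ ys} (there m) = inj₂ m

  consec-middle : ∀ P (a b c : A) R → (b , c) ∈ consec (P ++ a ∷ b ∷ c ∷ R)
  consec-middle [] a b c R = there (here refl)
  consec-middle (p ∷ []) a b c R = there (consec-middle [] a b c R)
  consec-middle (p ∷ q ∷ P) a b c R = there (consec-middle (q ∷ P) a b c R)

  consec-succ : ∀ (P : List A) {a b c : A} {R x} → b ∉ P → b ≢ a → b ∉ c ∷ R →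
                (b , x) ∈ consec (P ++ a ∷ b ∷ c ∷ R) → x ≡ c
  consec-succ [] _ b≢a _ (here e) = ⊥-elim (b≢a (cong proj₁ e))
  consec-succ [] _ _ _ (there (here e)) = cong proj₂ e
  consec-succ [] _ _ b∉R (there (there m)) = ⊥-elim (b∉R (proj₁ (consec-mem m)))
  consec-succ (p ∷ P) b∉P b≢a b∉R m with consec-∷⁻ {xs = P ++ _} m
  ... | inj₁ (b≡p , _) = ⊥-elim (b∉P (here b≡p))
  ... | inj₂ m' = consec-succ P (b∉P ∘ there) b≢a b∉R m'

  consec-pred : ∀ (P : List A) {a b c : A} {R x} → b ∉ P → b ≢ a → b ∉ c ∷ R →
                (x , b) ∈ consec (P ++ a ∷ b ∷ c ∷ R) → x ≡ a
  consec-pred [] _ _ _ (here e) = cong proj₁ e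
  consec-pred [] _ _ b∉R (there (here e)) = ⊥-elim (b∉R (here (cong proj₂ e)))
  consec-pred [] _ _ b∉R (there (there m)) = ⊥-elim (b∉R (proj₂ (consec-mem m)))
  consec-pred (p ∷ P) b∉P b≢a b∉R m with consec-∷⁻ {xs = P ++ _} m
  ... | inj₂ m' = consec-pred P (b∉P ∘ there) b≢a b∉R m'
  ... | inj₁ (_ , _ , e) with head-++ P e
  ...   | inj₁ b≡a = ⊥-elim (b≢a b≡a)
  ...   | inj₂ b∈P = ⊥-elim (b∉P (there b∈P))

PreservesCycle : {A : Set} → (A → A) → List A → Set
PreservesCycle s L = ∀ {b c} → (b , c) ∈ cyclePairs L →
  (s b , s c) ∈ cyclePairs L ⊎ (s c , s b) ∈ cyclePairs L

-- Walking along L, a fixed edge a-b forces the next vertex c to be fixed,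
-- since c and a are the only cycle-neighbours of b and s c ≢ s a = a.
module CycleRigidity {A : Set} (s : A → A) (s-inj : Injective _≡_ _≡_ s)
  (x₀ : A) (xs : List A) (uniq : Unique (x₀ ∷ xs)) (pres : PreservesCycle s (x₀ ∷ xs)) where

  module _ (P : List A) (a b c : A) (S : List A) (eq : P ++ a ∷ b ∷ c ∷ S ≡ x₀ ∷ xs) where
    R : List A
    R = S ++ [ x₀ ]

    closed : P ++ a ∷ b ∷ c ∷ R ≡ (x₀ ∷ xs) ++ [ x₀ ]
    closed = trans (sym (++-assoc P (a ∷ b ∷ c ∷ S) [ x₀ ])) (cong (_++ [ x₀ ]) eq)

    edge : (b , c) ∈ cyclePairs (x₀ ∷ xs)
    edge = subst (λ L → (b , c) ∈ consec L) closed (consec-middle P a b c R)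

    on-path : ∀ {u v} → (u , v) ∈ cyclePairs (x₀ ∷ xs) → (u , v) ∈ consec (P ++ a ∷ b ∷ c ∷ R)
    on-path = subst (λ L → (_ , _) ∈ consec L) (sym closed)

    unique-path : Unique (P ++ a ∷ b ∷ c ∷ S)
    unique-path = subst Unique (sym eq) uniq

    unique-suffix : Unique (a ∷ b ∷ c ∷ S)
    unique-suffix = unique-++ʳ P unique-path

    a∉ : a ∉ b ∷ c ∷ S
    a∉ = Unique.Unique[x∷xs]⇒x∉xs unique-suffix

    b≢a : b ≢ a
    b≢a b≡a = a∉ (here (sym b≡a))

    c≢a : c ≢ a
    c≢a c≡a = a∉ (there (here (sym c≡a)))

    b∉P : b ∉ P
    b∉P = unique-++-disjoint P unique-path (there (here refl))

    -- b ≢ x₀, as x₀ is a or lies in P.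
    b∉R : b ∉ c ∷ R
    b∉R b∈ with ∈-++⁻ (c ∷ S) b∈
    ... | inj₁ b∈cS = Unique.Unique[x∷xs]⇒x∉xs (tail unique-suffix) b∈cS
    ... | inj₂ (here b≡x₀) with head-++ P eq
    ...   | inj₁ x₀≡a = b≢a (trans b≡x₀ x₀≡a)
    ...   | inj₂ x₀∈P = b∉P (subst (_∈ P) (sym b≡x₀) x₀∈P)

    successor-of-b : ∀ {x} → (b , x) ∈ cyclePairs (x₀ ∷ xs) → x ≡ c
    successor-of-b = consec-succ P b∉P b≢a b∉R ∘ on-path

    predecessor-of-b : ∀ {x} → (x , b) ∈ cyclePairs (x₀ ∷ xs) → x ≡ a
    predecessor-of-b = consec-pred P b∉P b≢a b∉R ∘ on-path

    -- If a and b are fixed, the image of the edge b-c is b-(s c) or (s c)-b;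
    -- the second would give s c = a = s a, so c = a.
    successor-fixed : s a ≡ a → s b ≡ b → s c ≡ c
    successor-fixed sa≡a sb≡b with pres edge
    ... | inj₁ e = successor-of-b (subst (λ z → (z , s c) ∈ _) sb≡b e)
    ... | inj₂ e = ⊥-elim (c≢a (s-inj (trans sc≡a (sym sa≡a))))
      where
      sc≡a : s c ≡ a
      sc≡a = predecessor-of-b (subst (λ z → (s c , z) ∈ _) sb≡b e)

  walk : ∀ P a b S → P ++ a ∷ b ∷ S ≡ x₀ ∷ xs → s a ≡ a → s b ≡ b → ∀ {x} → x ∈ S → s x ≡ x
  walk P a b (c ∷ S) eq sa≡a sb≡b (here refl) = successor-fixed P a b c S eq sa≡a sb≡b
  walk P a b (c ∷ S) eq sa≡a sb≡b (there x∈S) =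
    walk (P ++ [ a ]) b c S (trans (++-assoc P [ a ] _) eq) sb≡b (successor-fixed P a b c S eq sa≡a sb≡b) x∈S

cycle-rigid : {A : Set} (s : A → A) → Injective _≡_ _≡_ s → (L : List A) → Unique L →
              PreservesCycle s L → (∀ {x} → x ∈ take 2 L → s x ≡ x) → ∀ {x} → x ∈ L → s x ≡ x
cycle-rigid s s-inj (a ∷ []) _ _ fix x∈L = fix x∈L
cycle-rigid s s-inj (a ∷ b ∷ R) _ _ fix (here refl) = fix (here refl)
cycle-rigid s s-inj (a ∷ b ∷ R) _ _ fix (there (here refl)) = fix (there (here refl))
cycle-rigid s s-inj (a ∷ b ∷ R) u pres fix (there (there x∈R)) =
  CycleRigidity.walk s s-inj a (b ∷ R) u pres [] a b R refl (fix (here refl)) (fix (there (here refl))) x∈R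

↔-injective : ∀ {A B : Set} (e : A ↔ B) → Injective _≡_ _≡_ (Inverse.to e)
↔-injective e = Injection.injective (Inverse⇒Injection e)

CompleteAt : (G : Graph) → V G → V G → Set
CompleteAt G u v = (Adj G u v → u ≢ v) × (u ≢ v → Adj G u v)

Complete : Graph → Set
Complete G = ∀ u v → CompleteAt G u v

permutation-aut : (G : Graph) → Complete G → V G ↔ V G → Aut G
permutation-aut G complete π = record
  { bij = π
  ; preserve = λ u v uv →
      proj₂ (complete _ _) (λ πu≡πv → proj₁ (complete u v) uv (↔-injective π πu≡πv))
  ; reflect = λ u v πuπv →
      proj₂ (complete u v) (λ u≡v → proj₁ (complete _ _) πuπv (cong (Inverse.to π) u≡v))
  }

transpose-preserves : ∀ {n} {B : Set} (ψ : Fin n → B) {i j} → ψ i ≡ ψ j → ∀ k → ψ (PC.transpose i j k) ≡ ψ k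
transpose-preserves ψ {i} {j} ψi≡ψj k with k ≟ i
... | yes refl = sym ψi≡ψj
... | no _ with k ≟ j
...   | yes refl = ψi≡ψj
...   | no _ = refl

transpose-moves : ∀ {n} (i j : Fin n) → PC.transpose i j i ≡ j
transpose-moves i j with i ≟ i
... | yes _ = refl
... | no i≢i = ⊥-elim (i≢i refl)

-- A complete graph on n vertices has no r-distinguishing labeling for r < n:
-- two vertices share a label by the pigeonhole principle, and swapping them is
-- a label-preserving automorphism that is not the identity.
complete-needs-all-labels : (G : Graph) → Complete G → ∀ {n} → V G ↔ Fin n → ∀ r → r < n → ¬ HasDist G r
complete-needs-all-labels G complete e r r<n (φ , distinguishing)
  with pigeonhole r<n (φ ∘ Inverse.from e)
... | i , j , i<j , same-label = <ᶠ-irrefl (sym j≡i) i<j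
  where
  open Inverse e using (to; from; strictlyInverseˡ; strictlyInverseʳ)
  swap : V G ↔ V G
  swap = ↔-trans e (↔-trans (transpose i j) (↔-sym e))

  swap-preserves : ∀ v → φ (Inverse.to swap v) ≡ φ v
  swap-preserves v = trans (transpose-preserves (λ k → φ (from k)) same-label (to v)) (cong φ (strictlyInverseʳ v))

  swap-moves : Inverse.to swap (from i) ≡ from j
  swap-moves = cong from (trans (cong (PC.transpose i j) (strictlyInverseˡ i)) (transpose-moves i j))

  j≡i : j ≡ i
  j≡i = ↔-injective (↔-sym e)
          (trans (sym swap-moves) (distinguishing (permutation-aut G complete swap) swap-preserves (from i)))

_≟P_ : ∀ {t} → DecidableEquality (Pos t)
_≟L_ : ∀ {ts} → DecidableEquality (PosL ts)
root ≟P root = yes refl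
root ≟P sub _ = no λ ()
sub _ ≟P root = no λ ()
sub l ≟P sub m with l ≟L m
... | yes refl = yes refl
... | no l≢m = no λ { refl → l≢m refl }
here p ≟L here q with p ≟P q
... | yes refl = yes refl
... | no p≢q = no λ { refl → p≢q refl }
here _ ≟L there _ = no λ ()
there _ ≟L here _ = no λ ()
there l ≟L there m with l ≟L m
... | yes refl = yes refl
... | no l≢m = no λ { refl → l≢m refl }

allPos-complete : ∀ {t} (p : Pos t) → p ∈ allPos t
allPosL-complete : ∀ {ts} (l : PosL ts) → l ∈ allPosL ts
allPos-complete root = here refl
allPos-complete (sub l) = there (∈-map⁺ sub (allPosL-complete l))
allPosL-complete {t ∷ ts} (here p) = ∈-++⁺ˡ (∈-map⁺ here (allPos-complete p))
allPosL-complete {t ∷ ts} (there l) = ∈-++⁺ʳ (map here (allPos t)) (∈-map⁺ there (allPosL-complete l))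

allPos-unique : ∀ t → Unique (allPos t)
allPosL-unique : ∀ ts → Unique (allPosL ts)
allPos-unique (node ts) =
  All.tabulate (λ m root≡p → let (_ , _ , p≡sub) = ∈-map⁻ sub m in root≢sub (trans root≡p p≡sub))
  ∷ Unique.map⁺ (λ { refl → refl }) (allPosL-unique ts)
  where
  root≢sub : ∀ {l} → root {ts} ≢ sub l
  root≢sub ()
allPosL-unique [] = []
allPosL-unique (t ∷ ts) = Unique.++⁺ (Unique.map⁺ (λ { refl → refl }) (allPos-unique t))
  (Unique.map⁺ (λ { refl → refl }) (allPosL-unique ts)) disjoint
  where
  here≢there : ∀ {p l} → PosL.here {t} {ts} p ≢ there l
  here≢there ()
  disjoint : ∀ {l} → ¬ (l ∈ map here (allPos t) × l ∈ map there (allPosL ts))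
  disjoint (m₁ , m₂) =
    let (_ , _ , e₁) = ∈-map⁻ here m₁ ; (_ , _ , e₂) = ∈-map⁻ there m₂ in here≢there (trans (sym e₁) e₂)

top-not-child : ∀ {ts} {l l' : PosL ts} → TopL l → ¬ ParL l' l
top-not-child here (here ())
top-not-child (there top-l) (there par) = top-not-child top-l par

parent-unique : ∀ {t} {a b c : Pos t} → Par a c → Par b c → a ≡ b
parentL-unique : ∀ {ts} {a b c : PosL ts} → ParL a c → ParL b c → a ≡ b
parent-unique (top _) (top _) = refl
parent-unique (top top-c) (down par) = ⊥-elim (top-not-child top-c par)
parent-unique (down par) (top top-c) = ⊥-elim (top-not-child top-c par)
parent-unique (down p) (down q) = cong sub (parentL-unique p q)
parentL-unique (here p) (here q) = cong here (parent-unique p q)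
parentL-unique (there p) (there q) = cong there (parentL-unique p q)

parent-asym : ∀ {t} {a b : Pos t} → Par a b → ¬ Par b a
parentL-asym : ∀ {ts} {a b : PosL ts} → ParL a b → ¬ ParL b a
parent-asym (top _) ()
parent-asym (down p) (down q) = parentL-asym p q
parentL-asym (here p) (here q) = parent-asym p q
parentL-asym (there p) (there q) = parentL-asym p q

parent-of-sub : ∀ {ts} (l : PosL ts) → ∃ λ p → Par {node ts} p (sub l)
parentL : ∀ {ts} (l : PosL ts) → TopL l ⊎ ∃ λ l' → ParL l' l
parent-of-sub l with parentL l
... | inj₁ top-l = root , top top-l
... | inj₂ (l' , par) = sub l' , down par
parentL (here root) = inj₁ here
parentL (here (sub l)) = let (p , par) = parent-of-sub l in inj₂ (here p , here par)
parentL (there l) with parentL l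
... | inj₁ top-l = inj₁ (there top-l)
... | inj₂ (l' , par) = inj₂ (there l' , there par)

child? : ∀ {t} (v : Pos t) → (∃ λ c → Par v c) ⊎ (∀ c → ¬ Par v c)
childL? : ∀ {ts} (l : PosL ts) → (∃ λ c → ParL l c) ⊎ (∀ c → ¬ ParL l c)
child? {node []} root = inj₂ λ { root () ; (sub ()) _ }
child? {node (node _ ∷ _)} root = inj₁ (sub (here root) , top here)
child? (sub l) with childL? l
... | inj₁ (c , par) = inj₁ (sub c , down par)
... | inj₂ none = inj₂ λ { root () ; (sub c) (down par) → none c par }
childL? (here p) with child? p
... | inj₁ (c , par) = inj₁ (here c , here par)
... | inj₂ none = inj₂ λ { (here c) (here par) → none c par }
childL? (there l) with childL? l
... | inj₁ (c , par) = inj₁ (there c , there par)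
... | inj₂ none = inj₂ λ { (there c) (there par) → none c par }

treeHeight : PTree → ℕ
forestHeight : List PTree → ℕ
treeHeight (node ts) = suc (forestHeight ts)
forestHeight [] = 0
forestHeight (t ∷ ts) = treeHeight t ⊔ forestHeight ts

height : ∀ {t} → Pos t → ℕ
heightL : ∀ {ts} → PosL ts → ℕ
height {node ts} root = suc (forestHeight ts)
height (sub l) = heightL l
heightL (here p) = height p
heightL (there l) = heightL l

top-height : ∀ {ts} {l : PosL ts} → TopL l → heightL l ≤ forestHeight ts
top-height {node us ∷ ts} here = m≤m⊔n (suc (forestHeight us)) (forestHeight ts)
top-height {t ∷ ts} (there top-l) = ≤-trans (top-height top-l) (m≤n⊔m (treeHeight t) (forestHeight ts))

parent-height : ∀ {t} {a c : Pos t} → Par a c → height c < height a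
parentL-height : ∀ {ts} {a c : PosL ts} → ParL a c → heightL c < heightL a
parent-height (top top-c) = s≤s (top-height top-c)
parent-height (down par) = parentL-height par
parentL-height (here par) = parent-height par
parentL-height (there par) = parentL-height par

IsLeaf : (t : PTree) → Pos t → Set
IsLeaf t v = deg t v ≡ 1

two-neighbours-not-leaf : ∀ t {v a b : Pos t} → AdjT v a → AdjT v b → a ≢ b → ¬ IsLeaf t v
two-neighbours-not-leaf t {v} {a} {b} va vb a≢b leaf =
  <-irrefl refl (subst (2 ≤_) leaf (two-members-length (neighbour va) (neighbour vb) a≢b))
  where
  neighbour : ∀ {u} → AdjT v u → u ∈ filter (adjT? v) (allPos t)
  neighbour vu = ∈-filter⁺ (adjT? v) (allPos-complete _) vu

single-neighbour-leaf : ∀ t {v p : Pos t} → AdjT v p → (∀ {u} → AdjT v u → u ≡ p) → IsLeaf t v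
single-neighbour-leaf t {v} vp only =
  constant-unique-length {ys = filter (adjT? v) (allPos t)} (Unique.filter⁺ (adjT? v) (allPos-unique t))
    (∈-filter⁺ (adjT? v) (allPos-complete _) vp) (λ m → only (proj₂ (∈-filter⁻ (adjT? v) {xs = allPos t} m)))

-- In a tree with at least four vertices every non-leaf has a child: the root
-- has children, and a childless non-root vertex is adjacent only to its parent.
non-leaf-has-child : ∀ t → 4 ≤ order t → {v : Pos t} → ¬ IsLeaf t v → ∃ λ c → Par v c
non-leaf-has-child t large {v} not-leaf with child? v
... | inj₁ child = child
non-leaf-has-child (node []) (s≤s ()) {root} _ | inj₂ _
non-leaf-has-child (node (node _ ∷ _)) _ {root} _ | inj₂ none = ⊥-elim (none _ (top here))
non-leaf-has-child t _ {sub l} not-leaf | inj₂ none =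
  ⊥-elim (not-leaf (single-neighbour-leaf t (inj₂ parent) only-parent))
  where
  parent : Par (proj₁ (parent-of-sub l)) (sub l)
  parent = proj₂ (parent-of-sub l)
  only-parent : ∀ {u} → AdjT (sub l) u → u ≡ proj₁ (parent-of-sub l)
  only-parent (inj₁ child) = ⊥-elim (none _ child)
  only-parent (inj₂ par) = parent-unique par parent

-- A non-root
-- parent has its own parent as a second neighbour; a root whose only child is a
-- leaf belongs to a tree with two vertices.
adjacent-leaves-impossible : ∀ t → 4 ≤ order t → {u v : Pos t} → Par u v → IsLeaf t u → IsLeaf t v → ⊥
adjacent-leaves-impossible t _ {sub l} uv u-leaf _ =
  two-neighbours-not-leaf t (inj₂ parent) (inj₁ uv) (λ { refl → parent-asym uv parent }) u-leaf
  where
  parent : Par (proj₁ (parent-of-sub l)) (sub l)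
  parent = proj₂ (parent-of-sub l)
adjacent-leaves-impossible (node (node [] ∷ [])) (s≤s (s≤s ())) {root} (top here)
adjacent-leaves-impossible t@(node (node (node _ ∷ _) ∷ [])) _ {root} (top here) _ v-leaf =
  two-neighbours-not-leaf t (inj₂ (top here)) (inj₁ (down (here (top here)))) (λ ()) v-leaf
adjacent-leaves-impossible t@(node (node _ ∷ node _ ∷ _)) _ {root} _ u-leaf _ =
  two-neighbours-not-leaf t (inj₁ (top here)) (inj₁ (top (there here))) (λ ()) u-leaf

module _ {A : Set} (_≟ᴬ_ : DecidableEquality A) where

  markSecond : List A → A → Fin 4
  markSecond [] _ = # 0
  markSecond (b ∷ _) v with v ≟ᴬ b
  ... | yes _ = # 2
  ... | no _ = # 0

  markFirstTwo : List A → A → Fin 4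
  markFirstTwo [] _ = # 0
  markFirstTwo (a ∷ r) v with v ≟ᴬ a
  ... | yes _ = # 1
  ... | no _ = markSecond r v

  markSecond-head : ∀ b r → markSecond (b ∷ r) b ≡ # 2
  markSecond-head b r with b ≟ᴬ b
  ... | yes _ = refl
  ... | no b≢b = ⊥-elim (b≢b refl)

  markSecond-other : ∀ b r {y} → y ≢ b → markSecond (b ∷ r) y ≡ # 0
  markSecond-other b r {y} y≢b with y ≟ᴬ b
  ... | yes y≡b = ⊥-elim (y≢b y≡b)
  ... | no _ = refl

  markSecond-not-1 : ∀ r v → markSecond r v ≢ # 1
  markSecond-not-1 (b ∷ _) v e with v ≟ᴬ b
  markSecond-not-1 (b ∷ _) v () | yes _
  markSecond-not-1 (b ∷ _) v () | no _

  markFirstTwo-head : ∀ a r → markFirstTwo (a ∷ r) a ≡ # 1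
  markFirstTwo-head a r with a ≟ᴬ a
  ... | yes _ = refl
  ... | no a≢a = ⊥-elim (a≢a refl)

  markFirstTwo-tail : ∀ a r {y} → y ≢ a → markFirstTwo (a ∷ r) y ≡ markSecond r y
  markFirstTwo-tail a r {y} y≢a with y ≟ᴬ a
  ... | yes y≡a = ⊥-elim (y≢a y≡a)
  ... | no _ = refl

  mark-not-3 : ∀ L v → markFirstTwo L v ≢ # 3
  mark-not-3 (a ∷ r) v e with v ≟ᴬ a
  mark-not-3 (a ∷ r) v () | yes _
  mark-not-3 (a ∷ []) v () | no _
  mark-not-3 (a ∷ b ∷ r) v e | no _ with v ≟ᴬ b
  mark-not-3 (a ∷ b ∷ r) v () | no _ | yes _
  mark-not-3 (a ∷ b ∷ r) v () | no _ | no _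

  mark-first : ∀ a r y → markFirstTwo (a ∷ r) y ≡ markFirstTwo (a ∷ r) a → y ≡ a
  mark-first a r y e with y ≟ᴬ a
  ... | yes y≡a = y≡a
  ... | no _ = ⊥-elim (markSecond-not-1 r y (trans e (markFirstTwo-head a r)))

  mark-two : ∀ a b r y → markFirstTwo (a ∷ b ∷ r) y ≡ # 2 → y ≡ b
  mark-two a b r y e with y ≟ᴬ b | y ≟ᴬ a
  ... | yes y≡b | _ = y≡b
  ... | no _ | yes _ = ⊥-elim (1≢2 e)
    where
    1≢2 : # 1 ≢ # 2
    1≢2 ()
  ... | no y≢b | no _ =
    ⊥-elim (0≢2 (trans (sym (markSecond-other b r y≢b)) e))
    where
    0≢2 : # 0 ≢ # 2
    0≢2 ()

  mark-second : ∀ a b r y → b ≢ a → markFirstTwo (a ∷ b ∷ r) y ≡ markFirstTwo (a ∷ b ∷ r) b → y ≡ b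
  mark-second a b r y b≢a e =
    mark-two a b r y (trans e (trans (markFirstTwo-tail a (b ∷ r) b≢a) (markSecond-head b r)))

  mark-determines : ∀ {L x y} → Unique L → x ∈ take 2 L → markFirstTwo L y ≡ markFirstTwo L x → y ≡ x
  mark-determines {a ∷ r} _ (here refl) = mark-first a r _
  mark-determines {a ∷ b ∷ r} (a∉ ∷ _) (there (here refl)) =
    mark-second a b r _ (λ b≡a → All.lookup a∉ (here refl) (sym b≡a))

halinLabel : (t : PTree) → Pos t → Fin 4
halinLabel t v with deg t v ≟ℕ 1
... | yes _ = markFirstTwo _≟P_ (leaves t) v
... | no _ = # 3

label-leaf : ∀ t {v} → IsLeaf t v → halinLabel t v ≡ markFirstTwo _≟P_ (leaves t) v
label-leaf t {v} leaf with deg t v ≟ℕ 1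
... | yes _ = refl
... | no not-leaf = ⊥-elim (not-leaf leaf)

label-non-leaf : ∀ t {v} → ¬ IsLeaf t v → halinLabel t v ≡ # 3
label-non-leaf t {v} not-leaf with deg t v ≟ℕ 1
... | yes leaf = ⊥-elim (not-leaf leaf)
... | no _ = refl

leaves-unique : ∀ t → Unique (leaves t)
leaves-unique t = Unique.filter⁺ (λ v → deg t v ≟ℕ 1) (allPos-unique t)

leaves-leaf : ∀ t {v} → v ∈ leaves t → IsLeaf t v
leaves-leaf t v∈ = proj₂ (∈-filter⁻ (λ v → deg t v ≟ℕ 1) {xs = allPos t} v∈)

leaf-leaves : ∀ t {v} → IsLeaf t v → v ∈ leaves t
leaf-leaves t {v} leaf = ∈-filter⁺ (λ v → deg t v ≟ℕ 1) (allPos-complete v) leaf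

module LabelPreserving (t : PTree) (large : 4 ≤ order t) (σ : Aut (Halin t))
  (preserves : ∀ v → halinLabel t (Inverse.to (Iso.bij σ) v) ≡ halinLabel t v) where

  s : Pos t → Pos t
  s = Inverse.to (Iso.bij σ)

  -- Label 3 marks exactly the non-leaves, so s maps leaves to leaves and
  -- non-leaves to non-leaves.
  leaf-to-leaf : ∀ {v} → IsLeaf t v → IsLeaf t (s v)
  leaf-to-leaf {v} leaf with deg t (s v) ≟ℕ 1
  ... | yes leaf' = leaf'
  ... | no not-leaf' = ⊥-elim (mark-not-3 _≟P_ (leaves t) v
          (trans (sym (label-leaf t leaf)) (trans (sym (preserves v)) (label-non-leaf t not-leaf'))))

  non-leaf-to-non-leaf : ∀ {v} → ¬ IsLeaf t v → ¬ IsLeaf t (s v)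
  non-leaf-to-non-leaf {v} not-leaf leaf' = mark-not-3 _≟P_ (leaves t) (s v)
    (trans (sym (label-leaf t leaf')) (trans (preserves v) (label-non-leaf t not-leaf)))

  -- The first two leaves carry labels no other vertex has.
  first-two-fixed : ∀ {x} → x ∈ take 2 (leaves t) → s x ≡ x
  first-two-fixed {x} x∈ = mark-determines _≟P_ (leaves-unique t) x∈
    (trans (sym (label-leaf t (leaf-to-leaf leaf))) (trans (preserves x) (label-leaf t leaf)))
    where
    leaf : IsLeaf t x
    leaf = leaves-leaf t (take-⊆ 2 x∈)

  -- Edges between leaves in the Halin graph are cycle edges, since in a tree
  -- with at least four vertices no two leaves are adjacent.
  cycle-preserved : PreservesCycle s (leaves t)
  cycle-preserved {b} {c} bc = image (Iso.preserve σ b c (inj₂ (inj₁ bc)))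
    where
    sb-leaf : IsLeaf t (s b)
    sb-leaf = leaf-to-leaf (leaves-leaf t (proj₁ (cyclePairs-mem bc)))
    sc-leaf : IsLeaf t (s c)
    sc-leaf = leaf-to-leaf (leaves-leaf t (proj₂ (cyclePairs-mem bc)))
    image : Adj (Halin t) (s b) (s c) → AdjC (s b) (s c)
    image (inj₂ cycle-edge) = cycle-edge
    image (inj₁ (inj₁ par)) = ⊥-elim (adjacent-leaves-impossible t large par sb-leaf sc-leaf)
    image (inj₁ (inj₂ par)) = ⊥-elim (adjacent-leaves-impossible t large par sc-leaf sb-leaf)

  leaves-fixed : ∀ {x} → IsLeaf t x → s x ≡ x
  leaves-fixed leaf = cycle-rigid s (↔-injective (Iso.bij σ)) (leaves t) (leaves-unique t)
                        cycle-preserved first-two-fixed (leaf-leaves t leaf)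

module TreeRigidity (t : PTree) (large : 4 ≤ order t) (σ : Aut (Halin t))
  (non-leaf-to-non-leaf : ∀ {v} → ¬ IsLeaf t v → ¬ IsLeaf t (Inverse.to (Iso.bij σ) v))
  (leaves-fixed : ∀ {v} → IsLeaf t v → Inverse.to (Iso.bij σ) v ≡ v) where

  s : Pos t → Pos t
  s = Inverse.to (Iso.bij σ)

  -- For a non-leaf v with a fixed child c, s v is a non-leaf neighbour of c,
  -- so it is joined to c by a tree edge: either s v is the parent v of c, or a
  -- child of c, which is lower than v and hence fixed, so again s v = v.
  parent-of-fixed : ∀ {v c} → ¬ IsLeaf t v → Par v c → s c ≡ c →
                    (∀ {w} → height w < height v → s w ≡ w) → s v ≡ v
  parent-of-fixed {v} {c} not-leaf vc sc≡c lower-fixed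
    with subst (Adj (Halin t) (s v)) sc≡c (Iso.preserve σ v c (inj₁ (inj₁ vc)))
  ... | inj₁ (inj₁ par) = parent-unique par vc
  ... | inj₁ (inj₂ par) = ↔-injective (Iso.bij σ) (lower-fixed (<-trans (parent-height par) (parent-height vc)))
  ... | inj₂ (inj₁ cyc) = ⊥-elim (non-leaf-to-non-leaf not-leaf (leaves-leaf t (proj₁ (cyclePairs-mem cyc))))
  ... | inj₂ (inj₂ cyc) = ⊥-elim (non-leaf-to-non-leaf not-leaf (leaves-leaf t (proj₂ (cyclePairs-mem cyc))))

  fixed-if-lower-fixed : ∀ v → (∀ {w} → height w < height v → s w ≡ w) → s v ≡ v
  fixed-if-lower-fixed v lower-fixed with deg t v ≟ℕ 1
  ... | yes leaf = leaves-fixed leaf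
  ... | no not-leaf = let (c , vc) = non-leaf-has-child t large not-leaf in
                      parent-of-fixed not-leaf vc (lower-fixed (parent-height vc)) lower-fixed

  all-fixed : ∀ v → s v ≡ v
  all-fixed = WF.All.wfRec (On.wellFounded height <-wellFounded) Level.zero (λ v → s v ≡ v) fixed-if-lower-fixed

halin-distinguishing : ∀ t → 4 ≤ order t → Distinguishing (Halin t) 4 (halinLabel t)
halin-distinguishing t large σ preserves =
  TreeRigidity.all-fixed t large σ non-leaf-to-non-leaf leaves-fixed
  where open LabelPreserving t large σ preserves

halinAdj? : ∀ t (u v : Pos t) → Dec (Adj (Halin t) u v)
halinAdj? t u v = adjT? u v ⊎-dec ((u , v) ∈? cyclePairs (leaves t) ⊎-dec (v , u) ∈? cyclePairs (leaves t))
  where open DecMembership (≡-dec _≟P_ _≟P_)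

halinCompleteAt? : ∀ t (u v : Pos t) → Dec (CompleteAt (Halin t) u v)
halinCompleteAt? t u v = (halinAdj? t u v →-dec ¬? (u ≟P v)) ×-dec (¬? (u ≟P v) →-dec halinAdj? t u v)

halin-complete-by-evaluation : ∀ t →
  True (all? (λ u → all? (halinCompleteAt? t u) (allPos t)) (allPos t)) → Complete (Halin t)
halin-complete-by-evaluation t checked u v =
  All.lookup (All.lookup (toWitness checked) (allPos-complete u)) (allPos-complete v)

-- A tree with four vertices and no vertex of degree two is the star K_{1,3},
-- rooted at its centre or at a leaf; its Halin graph is complete (it is K₄).
four-vertex-halin-complete : ∀ t → order t ≡ 4 → (∀ v → deg t v ≢ 2) → Complete (Halin t)
four-vertex-halin-complete (node []) ()
four-vertex-halin-complete (node (node [] ∷ [])) ()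
four-vertex-halin-complete (node (node [] ∷ node [] ∷ [])) ()
four-vertex-halin-complete t@(node (node [] ∷ node [] ∷ node [] ∷ [])) refl _ = halin-complete-by-evaluation t _
four-vertex-halin-complete (node (node [] ∷ node [] ∷ node [] ∷ node _ ∷ _)) ()
four-vertex-halin-complete (node (node [] ∷ node [] ∷ node (node _ ∷ _) ∷ _)) ()
four-vertex-halin-complete (node (node [] ∷ node (node [] ∷ []) ∷ [])) refl no-deg-2 = ⊥-elim (no-deg-2 root refl)
four-vertex-halin-complete (node (node [] ∷ node (node [] ∷ []) ∷ node _ ∷ _)) ()
four-vertex-halin-complete (node (node [] ∷ node (node [] ∷ node _ ∷ _) ∷ _)) ()
four-vertex-halin-complete (node (node [] ∷ node (node (node _ ∷ _) ∷ _) ∷ _)) ()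
four-vertex-halin-complete (node (node (node [] ∷ []) ∷ [])) ()
four-vertex-halin-complete (node (node (node [] ∷ []) ∷ node [] ∷ [])) refl no-deg-2 = ⊥-elim (no-deg-2 root refl)
four-vertex-halin-complete (node (node (node [] ∷ []) ∷ node [] ∷ node _ ∷ _)) ()
four-vertex-halin-complete (node (node (node [] ∷ []) ∷ node (node _ ∷ _) ∷ _)) ()
four-vertex-halin-complete t@(node (node (node [] ∷ node [] ∷ []) ∷ [])) refl _ = halin-complete-by-evaluation t _
four-vertex-halin-complete (node (node (node [] ∷ node [] ∷ []) ∷ node _ ∷ _)) ()
four-vertex-halin-complete (node (node (node [] ∷ node [] ∷ node _ ∷ _) ∷ _)) ()
four-vertex-halin-complete (node (node (node [] ∷ node (node _ ∷ _) ∷ _) ∷ _)) ()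
four-vertex-halin-complete (node (node (node (node [] ∷ []) ∷ []) ∷ [])) refl no-deg-2 =
  ⊥-elim (no-deg-2 (sub (here root)) refl)
four-vertex-halin-complete (node (node (node (node [] ∷ []) ∷ []) ∷ node _ ∷ _)) ()
four-vertex-halin-complete (node (node (node (node [] ∷ []) ∷ node _ ∷ _) ∷ _)) ()
four-vertex-halin-complete (node (node (node (node [] ∷ node _ ∷ _) ∷ _) ∷ _)) ()
four-vertex-halin-complete (node (node (node (node (node _ ∷ _) ∷ _) ∷ _) ∷ _)) ()

K13-order : ∀ t → Iso (TreeGraph t) K13 → order t ≤ 4
K13-order t iso = unique-length-≤ (allPos-unique t) (Inverse.to (Iso.bij iso)) (↔-injective (Iso.bij iso))

mainTheorem7 : (t : PTree) → 4 ≤ order t → (∀ v → ¬ deg t v ≡ 2) →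
    DLe (Halin t) 4 × (Iso (TreeGraph t) K13 → DEq (Halin t) 4)
mainTheorem7 t large no-deg-2 = (4 , ≤-refl , four-labels) , λ iso → four-labels , fewer-fail iso
  where
  four-labels : HasDist (Halin t) 4
  four-labels = halinLabel t , halin-distinguishing t large

  -- For T ≅ K_{1,3}: T has four vertices, so G is complete on four vertices.
  fewer-fail : Iso (TreeGraph t) K13 → ∀ r → r < 4 → ¬ HasDist (Halin t) r
  fewer-fail iso = complete-needs-all-labels (Halin t)
    (four-vertex-halin-complete t (≤-antisym (K13-order t iso) large) no-deg-2) (Iso.bij iso)
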